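{- Let $A$ and $B$ be non-empty finite sets, $h:B\to A$ an onto function and $u$ a creature acting on $B$; let $v=h[u]$ be the creature acting on $A$ given by $v_a=u_{h^{ -1}(a)}$ and $\pi_{v,a^*,a}=\pi_{u,h^{ -1}(a^*),h^{ -1}(a)}$ for $a\subseteq a^*\subseteq A$. Then for each $n\in\omega$, if $\mathrm{nor}(u)\geq n$ then $\mathrm{nor}(v)\geq n$.
   Context: For a non-empty finite set $A$, a creature acting on $A$ is a pair $u=\langle\langle u_a:a\subseteq A\rangle,\langle\pi_{u,b,a}:a\subseteq b\subseteq A\rangle\rangle$ where each $u_a$ is a non-empty finite set, each $\pi_{u,b,a}:u_b\to u_a$ is onto, and $\pi_{u,c,a}=\pi_{u,b,a}\circ\pi_{u,c,b}$ whenever $a\subseteq b\subseteq c\subseteq A$. For such $u$, $\Sigma(u)$ is the set of creatures $v$ acting on $A$ with $v_a\subseteq u_a$ for all $a\subseteq A$ and $\pi_{v,b,a}=\pi_{u,b,a}\restriction v_b$ for all $a\subseteq b\subseteq A$. Norm: "$\mathrm{nor}(u)\geq n$" is defined by induction on $n$: $\mathrm{nor}(u)\geq0$ always; $\mathrm{nor}(u)\geq n+1$ iff (a) for each $a\subseteq A$, whenever $u_a=u^0\cup u^1$ there are $v\in\Sigma(u)$ and $i\in\{0,1\}$ with $\mathrm{nor}(v)\geq n$ and $v_a\subseteq u^i$; and (b) for all $a,b\subseteq A$ with $b\not\subseteq a$ and every function $F:\mathcal{P}(u_a)\to u_b$ there is $v\in\Sigma(u)$ with $\mathrm{nor}(v)\geq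 n$ and $F''\mathcal{P}(v_a)\cap v_b=\emptyset$. -}

module Defs where

open import Data.Nat using (ℕ; zero; suc; _<_)
open import Data.Fin using (Fin)
open import Data.Fin.Subset using (Subset; _∈_; _∉_; _⊆_; _∪_; ⊤)
open import Data.Vec using (lookup; tabulate)
open import Data.Vec.Properties using (lookup∘tabulate; []=⇒lookup; lookup⇒[]=)
open import Data.Product using (Σ; ∃; _×_; _,_)
open import Data.Sum using (_⊎_)
open import Data.Unit using () renaming (⊤ to Unit)
open import Relation.Nullary using (¬_)
open import Relation.Binary.PropositionalEquality using (_≡_; refl; trans; sym)

-- A finite set A is modelled as Fin m; its subsets as Subset m.
-- A creature acting on Fin m: for each a ⊆ A a non-empty finite set u_a,
-- modelled as Fin (size a) with size a > 0, and maps π b a : u_b → u_a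
-- (π b a is only constrained when a ⊆ b; values for other pairs are unused).
record Creature (m : ℕ) : Set where
  field
    size     : Subset m → ℕ
    size-pos : ∀ a → 0 < size a
    π        : (b a : Subset m) → Fin (size b) → Fin (size a)
    π-onto   : ∀ {a b} → a ⊆ b → ∀ (x : Fin (size a)) → ∃ λ y → π b a y ≡ x
    π-comp   : ∀ {a b c} → a ⊆ b → b ⊆ c →
               ∀ (z : Fin (size c)) → π c a z ≡ π b a (π c b z)

open Creature public

-- An element v of Σ(u): v_a ⊆ u_a for every a, v a creature with the
-- restricted projections.  Such a v is determined by the family of
-- subsets v_a; the conditions say each v_a is non-empty and
-- π_{u,b,a} restricted to v_b maps v_b onto v_a (composition is inherited).
record Sub {m : ℕ} (u : Creature m) : Set where
  field
    car      : (a : Subset m) → Subset (size u a)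
    car-ne   : ∀ a → ∃ λ x → x ∈ car a
    car-into : ∀ {a b} → a ⊆ b → ∀ {y} → y ∈ car b → π u b a y ∈ car a
    car-onto : ∀ {a b} → a ⊆ b → ∀ {x} → x ∈ car a →
               ∃ λ y → y ∈ car b × π u b a y ≡ x

open Sub public

-- w ∈ Σ(v) for sub-creatures v, w of u (then Σ(v) = {w ∈ Σ(u) | w ≤ v}).
_≤S_ : ∀ {m} {u : Creature m} → Sub u → Sub u → Set
w ≤S v = ∀ a → car w a ⊆ car v a

norGE : ∀ {m} {u : Creature m} → ℕ → Sub u → Set
norGE zero v = Unit
norGE {m} {u} (suc n) v =
  ((a : Subset m) → (U0 U1 : Subset (size u a)) → U0 ∪ U1 ≡ car v a →
     ∃ λ (w : Sub u) → w ≤S v × norGE n w × ((car w a ⊆ U0) ⊎ (car w a ⊆ U1)))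
  ×
  ((a b : Subset m) → ¬ (b ⊆ a) →
     (F : Subset (size u a) → Fin (size u b)) →
     (∀ X → X ⊆ car v a → F X ∈ car v b) →
     ∃ λ (w : Sub u) → w ≤S v × norGE n w ×
       (∀ X → X ⊆ car w a → F X ∉ car w b))

full : ∀ {m} (u : Creature m) → Sub u
full u = record
  { car = λ a → ⊤
  ; car-ne = λ a → ne (size u a) (size-pos u a)
  ; car-into = λ _ _ → Data.Fin.Subset.Properties.∈⊤
  ; car-onto = λ {a} {b} p {x} _ → let (y , e) = π-onto u p x in y , Data.Fin.Subset.Properties.∈⊤ , e
  }
  where
  import Data.Fin.Subset.Properties
  ne : ∀ k → 0 < k → ∃ λ (x : Fin k) → x ∈ ⊤
  ne (suc k) _ = Data.Fin.zero , Data.Fin.Subset.Properties.∈⊤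

norCreatureGE : ∀ {m} → Creature m → ℕ → Set
norCreatureGE u n = norGE n (full u)

preimage : ∀ {k m} → (Fin k → Fin m) → Subset m → Subset k
preimage h a = tabulate (λ j → lookup a (h j))

preimage-mono : ∀ {k m} (h : Fin k → Fin m) {a b : Subset m} →
                a ⊆ b → preimage h a ⊆ preimage h b
preimage-mono h {a} {b} p {j} jin =
  lookup⇒[]= j (preimage h b)
    (trans (lookup∘tabulate (λ j → lookup b (h j)) j)
      ([]=⇒lookup (p (lookup⇒[]= (h j) a
        (trans (sym (lookup∘tabulate (λ j → lookup a (h j)) j)) ([]=⇒lookup jin))))))

image : ∀ {k m} → (Fin k → Fin m) → Creature k → Creature m
image h u = record
  { size = λ a → size u (preimage h a)
  ; size-pos = λ a → size-pos u (preimage h a)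
  ; π = λ b a → π u (preimage h b) (preimage h a)
  ; π-onto = λ p → π-onto u (preimage-mono h p)
  ; π-comp = λ p q → π-comp u (preimage-mono h p) (preimage-mono h q)
  }

-- Pulling back along h⁻¹ sends every w ∈ Σ(u) to h[w] ∈ Σ(h[u]), monotonically, and the
-- clauses of nor(h[w]) ≥ n + 1 at sets a, b ⊆ A are exactly those of nor(w) ≥ n + 1 at
-- h⁻¹(a), h⁻¹(b). The only point needing surjectivity of h is that b ⊈ a forces
-- h⁻¹(b) ⊈ h⁻¹(a), so that clause (b) for u may be invoked.
module Submission where

open import Defs
open import Data.Nat using (ℕ; suc; zero)
open import Data.Fin using (Fin)
open import Data.Fin.Subset using (Subset; _∈_; _∉_; _⊆_; _∪_)
open import Data.Vec using (lookup; tabulate)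
open import Data.Vec.Properties using (lookup∘tabulate; []=⇒lookup; lookup⇒[]=)
open import Data.Product using (∃; _,_; _×_)
open import Data.Sum using (_⊎_)
open import Function using (_∘_)
open import Relation.Nullary using (¬_)
open import Relation.Binary.PropositionalEquality using (_≡_; sym; trans; subst)

module _ {k m : ℕ} (h : Fin k → Fin m) where

  ∈-preimage⁻ : ∀ {a : Subset m} {j} → j ∈ preimage h a → h j ∈ a
  ∈-preimage⁻ {a} {j} j∈ = lookup⇒[]= (h j) a
    (trans (sym (lookup∘tabulate (λ i → lookup a (h i)) j)) ([]=⇒lookup j∈))

  ∈-preimage⁺ : ∀ {a : Subset m} {j} → h j ∈ a → j ∈ preimage h a
  ∈-preimage⁺ {a} {j} hj∈ = lookup⇒[]= j (preimage h a)
    (trans (lookup∘tabulate (λ i → lookup a (h i)) j) ([]=⇒lookup hj∈))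

  preimage-reflects-⊆ : (∀ i → ∃ λ j → h j ≡ i) →
                        ∀ {a b : Subset m} → preimage h b ⊆ preimage h a → b ⊆ a
  preimage-reflects-⊆ surj {a} {b} pre⊆ {i} i∈b with surj i
  ... | j , hj≡i = subst (_∈ a) hj≡i
                     (∈-preimage⁻ (pre⊆ (∈-preimage⁺ (subst (_∈ b) (sym hj≡i) i∈b))))

  module _ {u : Creature k} where

    imageSub : Sub u → Sub (image h u)
    imageSub w = record
      { car      = car w ∘ preimage h
      ; car-ne   = car-ne w ∘ preimage h
      ; car-into = car-into w ∘ preimage-mono h
      ; car-onto = car-onto w ∘ preimage-mono h
      }

    imageSub-mono : ∀ {v w : Sub u} → v ≤S w → imageSub v ≤S imageSub w
    imageSub-mono v≤w = v≤w ∘ preimage h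

    norGE-imageSub : (∀ i → ∃ λ j → h j ≡ i) →
                     ∀ n (w : Sub u) → norGE n w → norGE n (imageSub w)
    norGE-imageSub surj zero    w _                     = _
    norGE-imageSub surj (suc n) w (splitting , avoiding) = splitting′ , avoiding′
      where
      splitting′ : (a : Subset m) (U₀ U₁ : Subset (size u (preimage h a))) →
                   U₀ ∪ U₁ ≡ car w (preimage h a) →
                   ∃ λ (x : Sub (image h u)) → x ≤S imageSub w × norGE n x ×
                     (car x a ⊆ U₀ ⊎ car x a ⊆ U₁)
      splitting′ a U₀ U₁ U₀∪U₁≡ with splitting (preimage h a) U₀ U₁ U₀∪U₁≡
      ... | x , x≤w , nor-x , x⊆Uᵢ =
        imageSub x , imageSub-mono {x} {w} x≤w , norGE-imageSub surj n x nor-x , x⊆Uᵢ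

      avoiding′ : (a b : Subset m) → ¬ (b ⊆ a) →
                  (F : Subset (size u (preimage h a)) → Fin (size u (preimage h b))) →
                  (∀ X → X ⊆ car w (preimage h a) → F X ∈ car w (preimage h b)) →
                  ∃ λ (x : Sub (image h u)) → x ≤S imageSub w × norGE n x ×
                    (∀ X → X ⊆ car x a → F X ∉ car x b)
      avoiding′ a b b⊈a F F∈
        with avoiding (preimage h a) (preimage h b) (b⊈a ∘ preimage-reflects-⊆ surj) F F∈
      ... | x , x≤w , nor-x , F∉ =
        imageSub x , imageSub-mono {x} {w} x≤w , norGE-imageSub surj n x nor-x , F∉

-- full (image h u) and imageSub h (full u) coincide definitionally.
mainTheorem6 : (k m : ℕ) (h : Fin (suc k) → Fin (suc m)) →
    (∀ (a : Fin (suc m)) → ∃ λ b → h b ≡ a) →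
    (u : Creature (suc k)) (n : ℕ) →
    norCreatureGE u n → norCreatureGE (image h u) n
mainTheorem6 k m h surj u n = norGE-imageSub h surj n (full u)
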